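{- For any star $S$ and any $n$-vertex tree $T$, $$\operatorname{gm}(S\mathbin{\Box} T)\le\sqrt{2n}+1.$$
   Context: A star is a tree consisting of one root vertex adjacent to all other vertices (the leaves). $\boxplus_k$ is the graph on $\{1,\dots,k\}^2$ with $(x,y)\sim(x',y')$ iff $|x-x'|+|y-y'|=1$; $\operatorname{gm}(G)$ is the maximum $k$ with $\boxplus_k$ a minor of $G$. The Cartesian product $G_1\mathbin{\Box} G_2$ has vertex set $V(G_1)\times V(G_2)$ with distinct $(u_1,u_2),(v_1,v_2)$ adjacent iff ($u_1=v_1$ and $u_2v_2\in E(G_2)$) or ($u_2=v_2$ and $u_1v_1\in E(G_1)$). -}

module Defs where

open import Level using (0ℓ)
open import Data.Nat using (ℕ; zero; suc; _+_; _*_; _∸_; _^_; _≤_; _<_; ∣_-_∣)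
open import Data.Fin using (Fin; toℕ)
open import Data.Maybe using (Maybe; just)
open import Data.Product using (Σ; _×_; _,_; ∃-syntax)
open import Data.Sum using (_⊎_)
open import Relation.Binary.PropositionalEquality using (_≡_; _≢_)
open import Relation.Nullary using (¬_)

record Graph : Set₁ where
  field
    V   : Set
    Adj : V → V → Set
open Graph public

IsSimple : Graph → Set
IsSimple G = (∀ u v → Adj G u v → Adj G v u) × (∀ v → ¬ Adj G v v)

data WalkIn (G : Graph) (P : V G → Set) : V G → V G → Set where
  here : ∀ {x} → P x → WalkIn G P x x
  step : ∀ {x z y} → P x → Adj G x z → WalkIn G P z y → WalkIn G P x y

Connected : Graph → Set
Connected G = ∀ x y → WalkIn G (λ _ → Data.Unit.⊤) x y
  where import Data.Unit

HasCycle : Graph → Set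
HasCycle G = Σ ℕ λ L → Σ (ℕ → V G) λ c →
    (3 ≤ L)
  × (∀ i j → i < j → j < L → c i ≢ c j)
  × (∀ i → suc i < L → Adj G (c i) (c (suc i)))
  × Adj G (c (L ∸ 1)) (c 0)

IsTree : Graph → Set
IsTree G = IsSimple G × Connected G × ¬ HasCycle G

IsStar : Graph → Set
IsStar G = IsTree G × Σ (V G) λ r → ∀ v → v ≢ r → Adj G r v

mkFin : (n : ℕ) → (Fin n → Fin n → Set) → Graph
mkFin n A = record { V = Fin n ; Adj = A }

_□_ : Graph → Graph → Graph
G₁ □ G₂ = record
  { V = V G₁ × V G₂
  ; Adj = λ { (u₁ , u₂) (v₁ , v₂) →
              (u₁ ≡ v₁ × Adj G₂ u₂ v₂) ⊎ (u₂ ≡ v₂ × Adj G₁ u₁ v₁) } }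

-- the k × k grid ⊞_k (coordinates 0..k-1 instead of 1..k)
Grid : ℕ → Graph
Grid k = record
  { V = Fin k × Fin k
  ; Adj = λ { (x , y) (x' , y') →
              ∣ toℕ x - toℕ x' ∣ + ∣ toℕ y - toℕ y' ∣ ≡ 1 } }

-- H is a minor of G: branch sets B_h = { g | β g ≡ just h } (pairwise disjoint
-- automatically), each nonempty and inducing a connected subgraph of G, with an
-- edge of G between B_h and B_h' whenever h ~ h' in H.
IsMinor : Graph → Graph → Set
IsMinor H G = Σ (V G → Maybe (V H)) λ β →
    (∀ h → Σ (V G) λ g → β g ≡ just h)
  × (∀ h x y → β x ≡ just h → β y ≡ just h → WalkIn G (λ g → β g ≡ just h) x y)
  × (∀ h h' → Adj H h h' → Σ (V G) λ x → Σ (V G) λ y →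
        β x ≡ just h × β y ≡ just h' × Adj G x y)

module Submission where

-- Split the k × k grid into ⌊k/2⌋² disjoint 2 × 2 squares. The branch sets of the four corners of a
-- square contain a cycle of S □ T, and every cycle of S □ T meets the root layer {root} × T twice:
-- off that layer it stays in one leaf copy of T (leaves of a star are non-adjacent), so a cycle
-- avoiding the layer is a cycle of T, and a cycle meeting it once would have its two neighbours of
-- the root vertex equal (same T-coordinate as the root vertex, same leaf via the rest of the cycle).
-- Distinct squares have disjoint branch sets, so 2⌊k/2⌋² ≤ n and (k − 1)² ≤ (2⌊k/2⌋)² ≤ 2n.

open import Defs
open import Data.Nat using (ℕ; zero; suc; _+_; _∸_; _*_; _^_; _≤_; _<_; _≤′_; ≤′-refl; ≤′-step; z≤n; s≤s; ∣_-_∣; ⌊_/2⌋)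
open import Data.Nat.Properties
open import Data.Fin.Patterns using (0F; 1F)
open import Data.Fin using (Fin; toℕ; inject≤; combine)
open import Data.Fin.Properties
  using (toℕ-inject≤; toℕ-combine; inject≤-injective; combine-injectiveˡ; combine-injectiveʳ; injective⇒≤; *↔×)
  renaming (_≟_ to _≟F_)
open import Data.Maybe using (Maybe; just)
open import Data.Maybe.Properties using (just-injective)
open import Data.Product
open import Data.Product.Properties using (≡-dec; ×-≡,≡→≡)
open import Data.Product.Function.NonDependent.Propositional using (_×-↔_)
open import Data.Sum using (_⊎_; inj₁; inj₂)
open import Data.Empty using (⊥; ⊥-elim)
open import Data.Unit using (⊤; tt)
open import Function using (_∘_; _↔_)
open import Function.Bundles using (Injection)
open import Function.Definitions using (Injective)
open import Function.Properties.Inverse using (↔-refl; ↔-trans; ↔⇒↣)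
open import Relation.Binary.Construct.Closure.ReflexiveTransitive using (Star; ε; _◅_; _◅◅_)
open import Relation.Binary.Definitions using (DecidableEquality; tri<; tri≈; tri>)
open import Relation.Binary.PropositionalEquality
open import Relation.Nullary using (¬_; Dec; yes; no; ¬?; _×-dec_)
open import Data.Nat.Solver using (module +-*-Solver)

constant-between : {A : Set} (f : ℕ → A) {a b : ℕ} → a ≤ b →
  (∀ t → a ≤ t → t < b → f t ≡ f (suc t)) → f a ≡ f b
constant-between f a≤b = go (≤⇒≤′ a≤b)
  where
  go : ∀ {a b} → a ≤′ b → (∀ t → a ≤ t → t < b → f t ≡ f (suc t)) → f a ≡ f b
  go ≤′-refl _ = refl
  go (≤′-step a≤′b) next =
    trans (go a≤′b λ t a≤t t<b → next t a≤t (m≤n⇒m≤1+n t<b)) (next _ (≤′⇒≤ a≤′b) ≤-refl)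

module Walk {V : Set} {R : V → V → Set} where

  length : ∀ {x y} → Star R x y → ℕ
  length ε = 0
  length (_ ◅ w) = suc (length w)

  -- Past its end a walk stays at its last vertex.
  vertexAt : ∀ {x y} → Star R x y → ℕ → V
  vertexAt {x} ε _ = x
  vertexAt {x} (_ ◅ w) zero = x
  vertexAt (_ ◅ w) (suc i) = vertexAt w i

  vertexAt-zero : ∀ {x y} (w : Star R x y) → vertexAt w 0 ≡ x
  vertexAt-zero ε = refl
  vertexAt-zero (_ ◅ w) = refl

  vertexAt-length : ∀ {x y} (w : Star R x y) → vertexAt w (length w) ≡ y
  vertexAt-length ε = refl
  vertexAt-length (_ ◅ w) = vertexAt-length w

  vertexAt-step : ∀ {x y} (w : Star R x y) i → i < length w → R (vertexAt w i) (vertexAt w (suc i))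
  vertexAt-step (r ◅ w) zero _ = subst (R _) (sym (vertexAt-zero w)) r
  vertexAt-step (_ ◅ w) (suc i) (s≤s i<len) = vertexAt-step w i i<len

  vertexAt-all : (P : V → Set) → (∀ {a b} → R a b → P b) →
    ∀ {x y} → P x → (w : Star R x y) → ∀ i → P (vertexAt w i)
  vertexAt-all P R⇒P px ε i = px
  vertexAt-all P R⇒P px (r ◅ w) zero = px
  vertexAt-all P R⇒P px (r ◅ w) (suc i) = vertexAt-all P R⇒P (R⇒P r) w i

  _∈ᵥ_ : ∀ {x y} → V → Star R x y → Set
  v ∈ᵥ w = ∃ λ i → i < suc (length w) × v ≡ vertexAt w i

  IsPath : ∀ {x y} → Star R x y → Set
  IsPath ε = ⊤
  IsPath {x} (_ ◅ w) = ¬ (x ∈ᵥ w) × IsPath w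

  IsPath⇒distinct : ∀ {x y} (w : Star R x y) → IsPath w →
    ∀ i j → i < j → j ≤ length w → vertexAt w i ≢ vertexAt w j
  IsPath⇒distinct (_ ◅ w) (x∉w , _) zero (suc j) _ (s≤s j≤len) eq = x∉w (j , s≤s j≤len , eq)
  IsPath⇒distinct (_ ◅ w) (_ , path) (suc i) (suc j) (s≤s i<j) (s≤s j≤len) =
    IsPath⇒distinct w path i j i<j j≤len

  suffix : ∀ {x y} (w : Star R x y) i → Star R (vertexAt w i) y
  suffix ε i = ε
  suffix (r ◅ w) zero = r ◅ w
  suffix (_ ◅ w) (suc i) = suffix w i

  suffix-path : ∀ {x y} (w : Star R x y) i → IsPath w → IsPath (suffix w i)
  suffix-path ε i _ = tt
  suffix-path (r ◅ w) zero path = path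
  suffix-path (_ ◅ w) (suc i) (_ , path) = suffix-path w i path

  shortcut : DecidableEquality V → ∀ {x y} → Star R x y → Σ (Star R x y) IsPath
  shortcut _≟_ ε = ε , tt
  shortcut _≟_ {x} {y} (r ◅ w) with shortcut _≟_ w
  ... | p , p-path with anyUpTo? (λ i → x ≟ vertexAt p i) (suc (length p))
  ... | yes (i , _ , x≡pᵢ) =
    subst (λ v → Σ (Star R v y) IsPath) (sym x≡pᵢ) (suffix p i , suffix-path p i p-path)
  ... | no x∉p = r ◅ p , x∉p , p-path

open Walk hiding (length)

record Cycle (G : Graph) : Set where
  field
    length   : ℕ
    vertex   : ℕ → V G
    3≤length : 3 ≤ length
    distinct : ∀ i j → i < j → j < length → vertex i ≢ vertex j
    adjacent : ∀ i → suc i < length → Adj G (vertex i) (vertex (suc i))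
    closing  : Adj G (vertex (length ∸ 1)) (vertex 0)

  hasCycle : HasCycle G
  hasCycle = length , vertex , 3≤length , distinct , adjacent , closing

module _ {G : Graph} {R : V G → V G → Set} (R⇒Adj : ∀ {a b} → R a b → Adj G a b) where

  2≤length : ∀ {v u} (w : Star R v u) → ¬ R v u → u ≢ v → 2 ≤ Walk.length w
  2≤length ε _ u≢v = ⊥-elim (u≢v refl)
  2≤length (r ◅ ε) ¬r _ = ⊥-elim (¬r r)
  2≤length (_ ◅ _ ◅ _) _ _ = s≤s (s≤s z≤n)

  closePath : ∀ {v u} (w : Star R v u) → IsPath w → Adj G u v → ¬ R v u → u ≢ v → Cycle G
  closePath w path u~v ¬r u≢v = record
    { length   = suc (Walk.length w)
    ; vertex   = vertexAt w
    ; 3≤length = s≤s (2≤length w ¬r u≢v)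
    ; distinct = λ i j i<j j<len → IsPath⇒distinct w path i j i<j (≤-pred j<len)
    ; adjacent = λ i i<len → R⇒Adj (vertexAt-step w i (≤-pred i<len))
    ; closing  = subst₂ (Adj G) (sym (vertexAt-length w)) (sym (vertexAt-zero w)) u~v
    }

module □-Steps (S T : Graph) where

  □-step-across : ∀ {x y : V (S □ T)} → Adj (S □ T) x y → proj₁ x ≢ proj₁ y → proj₂ x ≡ proj₂ y
  □-step-across (inj₁ (s≡s' , _)) s≢s' = ⊥-elim (s≢s' s≡s')
  □-step-across (inj₂ (t≡t' , _)) _ = t≡t'

  □-step-along : (∀ s → ¬ Adj S s s) → ∀ {x y : V (S □ T)} → Adj (S □ T) x y →
    proj₁ x ≡ proj₁ y → Adj T (proj₂ x) (proj₂ y)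
  □-step-along _ (inj₁ (_ , t~t')) _ = t~t'
  □-step-along loopless {x} (inj₂ (_ , s~s')) s≡s' = ⊥-elim (loopless _ (subst (Adj S (proj₁ x)) (sym s≡s') s~s'))

module StarProduct {S T : Graph} (_≟S_ : DecidableEquality (V S)) (star : IsStar S) (T-acyclic : ¬ HasCycle T) where

  open □-Steps S T

  root : V S
  root = proj₁ (proj₂ star)

  InRootLayer : V (S □ T) → Set
  InRootLayer x = proj₁ x ≡ root

  private
    symmetric : ∀ s s' → Adj S s s' → Adj S s' s
    symmetric = proj₁ (proj₁ (proj₁ star))

    loopless : ∀ s → ¬ Adj S s s
    loopless = proj₂ (proj₁ (proj₁ star))

    root-adjacent : ∀ s → s ≢ root → Adj S root s
    root-adjacent = proj₂ (proj₂ star)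

  leaves-nonadjacent : ∀ {s s'} → s ≢ root → s' ≢ root → ¬ Adj S s s'
  leaves-nonadjacent {s} {s'} s≢r s'≢r s~s' = proj₂ (proj₂ (proj₁ star)) (Cycle.hasCycle triangle)
    where
    corner : ℕ → V S
    corner 0 = root
    corner 1 = s
    corner _ = s'
    distinct : ∀ i j → i < j → j < 3 → corner i ≢ corner j
    distinct 0 1 _ _ = s≢r ∘ sym
    distinct 0 2 _ _ = s'≢r ∘ sym
    distinct 1 2 _ _ s≡s' = loopless s (subst (Adj S s) (sym s≡s') s~s')
    distinct (suc (suc _)) 2 (s≤s (s≤s ())) _
    distinct (suc zero) 1 (s≤s ()) _
    distinct _ (suc (suc (suc _))) _ (s≤s (s≤s (s≤s ())))
    adjacent : ∀ i → suc i < 3 → Adj S (corner i) (corner (suc i))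
    adjacent 0 _ = root-adjacent s s≢r
    adjacent 1 _ = s~s'
    adjacent (suc (suc _)) (s≤s (s≤s (s≤s ())))
    triangle : Cycle S
    triangle = record
      { length = 3 ; vertex = corner ; 3≤length = ≤-refl ; distinct = distinct
      ; adjacent = adjacent ; closing = symmetric root s' (root-adjacent s' s'≢r) }

  step-off-root : ∀ {x y} → Adj (S □ T) x y → (InRootLayer x × ¬ InRootLayer y) ⊎ (¬ InRootLayer x × InRootLayer y) →
    proj₂ x ≡ proj₂ y
  step-off-root x~y (inj₁ (rx , ¬ry)) = □-step-across x~y λ eq → ¬ry (trans (sym eq) rx)
  step-off-root x~y (inj₂ (¬rx , ry)) = □-step-across x~y λ eq → ¬rx (trans eq ry)

  step-in-leaves : ∀ {x y} → Adj (S □ T) x y → ¬ InRootLayer x → ¬ InRootLayer y → proj₁ x ≡ proj₁ y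
  step-in-leaves (inj₁ (s≡s' , _)) _ _ = s≡s'
  step-in-leaves (inj₂ (_ , s~s')) ¬rx ¬ry = ⊥-elim (leaves-nonadjacent ¬rx ¬ry s~s')

  module _ (C : Cycle (S □ T)) where
    open Cycle C

    private
      last : ℕ
      last = length ∸ 1

      suc-last : suc last ≡ length
      suc-last = trans (+-comm 1 last) (m∸n+n≡m (≤-trans (s≤s z≤n) 3≤length))

      last<length : last < length
      last<length = subst (last <_) suc-last ≤-refl

      2≤last : 2 ≤ last
      2≤last = ≤-pred (subst (3 ≤_) (sym suc-last) 3≤length)

      <length : ∀ {t} → t ≤ last → t < length
      <length t≤last = ≤-<-trans t≤last last<length

      root? : ∀ i → Dec (InRootLayer (vertex i))
      root? i = proj₁ (vertex i) ≟S root

    same-leaf : ∀ {a b} → a ≤ b → b < length →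
      (∀ t → a ≤ t → t ≤ b → ¬ InRootLayer (vertex t)) → proj₁ (vertex a) ≡ proj₁ (vertex b)
    same-leaf {a} {b} a≤b b<length leaf = constant-between (proj₁ ∘ vertex) a≤b λ t a≤t t<b →
      step-in-leaves (adjacent t (<-≤-trans (s≤s t<b) b<length))
        (leaf t a≤t (<⇒≤ t<b)) (leaf (suc t) (m≤n⇒m≤1+n a≤t) t<b)

    distinct-coordinates : ∀ i j → i < j → j < length →
      proj₁ (vertex i) ≡ proj₁ (vertex j) → proj₂ (vertex i) ≡ proj₂ (vertex j) → ⊥
    distinct-coordinates i j i<j j<length eq₁ eq₂ = distinct i j i<j j<length (×-≡,≡→≡ (eq₁ , eq₂))

    meets-root : ∃ λ i → i < length × InRootLayer (vertex i)
    meets-root with anyUpTo? root? length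
    ... | yes found = found
    ... | no none = ⊥-elim (T-acyclic (Cycle.hasCycle projected))
      where
      leaf : ∀ t → t < length → ¬ InRootLayer (vertex t)
      leaf t t<length rt = none (t , t<length , rt)
      same-star : ∀ i → i < length → proj₁ (vertex i) ≡ proj₁ (vertex 0)
      same-star i i<length = sym (same-leaf z≤n i<length λ t _ t≤i → leaf t (≤-<-trans t≤i i<length))
      along : ∀ i j → i < length → j < length → Adj (S □ T) (vertex i) (vertex j) →
        Adj T (proj₂ (vertex i)) (proj₂ (vertex j))
      along i j i<length j<length x~y =
        □-step-along loopless x~y (trans (same-star i i<length) (sym (same-star j j<length)))
      projected : Cycle T
      projected = record
        { length = length ; vertex = proj₂ ∘ vertex ; 3≤length = 3≤length
        ; distinct = λ i j i<j j<length → distinct-coordinates i j i<j j<length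
            (trans (same-star i (<-trans i<j j<length)) (sym (same-star j j<length)))
        ; adjacent = λ i i<length → along i (suc i) (<-trans (n<1+n i) i<length) i<length (adjacent i i<length)
        ; closing = along last 0 last<length (≤-<-trans z≤n last<length) closing }

    lone-root : ∀ i → i < length → InRootLayer (vertex i) →
      (∀ t → t < length → t ≢ i → ¬ InRootLayer (vertex t)) → ⊥
    lone-root zero _ r₀ leaf = distinct-coordinates 1 last 2≤last last<length
      (same-leaf 1≤last last<length λ t 1≤t t≤last → leaf t (<length t≤last) (>⇒≢ 1≤t))
      (trans (sym (step-off-root (adjacent 0 (<length 1≤last)) (inj₁ (r₀ , leaf 1 (<length 1≤last) λ ()))))
             (sym (step-off-root closing (inj₂ (leaf last last<length (>⇒≢ 1≤last) , r₀)))))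
      where
      1≤last : 1 ≤ last
      1≤last = ≤-trans (s≤s z≤n) 2≤last
    lone-root (suc p) sp<length rₛₚ leaf with m≤n⇒m<n∨m≡n (≤-pred (subst (suc p <_) (sym suc-last) sp<length))
    ... | inj₂ sp≡last = distinct-coordinates 0 p 0<p p<length
      (same-leaf z≤n p<length λ t _ t≤p → leaf t (≤-<-trans t≤p p<length) (<⇒≢ (s≤s t≤p)))
      (trans (sym (step-off-root closing (inj₁ (subst (InRootLayer ∘ vertex) sp≡last rₛₚ , ¬r₀))))
        (trans (cong (proj₂ ∘ vertex) (sym sp≡last))
               (sym (step-off-root (adjacent p sp<length) (inj₂ (leaf p p<length (<⇒≢ ≤-refl) , rₛₚ))))))
      where
      p<length : p < length
      p<length = <-trans (n<1+n p) sp<length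
      0<p : 0 < p
      0<p = ≤-pred (subst (2 ≤_) (sym sp≡last) 2≤last)
      ¬r₀ : ¬ InRootLayer (vertex 0)
      ¬r₀ = leaf 0 (≤-<-trans z≤n sp<length) λ ()
    ... | inj₁ sp<last = distinct-coordinates p (suc (suc p)) (≤-trans (n<1+n p) (n≤1+n (suc p))) ssp<length
      (sym (trans (same-leaf sp<last last<length λ t ssp≤t t≤last → leaf t (<length t≤last) (>⇒≢ ssp≤t))
        (trans (step-in-leaves closing (leaf last last<length (>⇒≢ sp<last)) ¬r₀)
               (same-leaf z≤n p<length λ t _ t≤p → leaf t (≤-<-trans t≤p p<length) (<⇒≢ (s≤s t≤p))))))
      (trans (step-off-root (adjacent p sp<length) (inj₂ (leaf p p<length (<⇒≢ ≤-refl) , rₛₚ)))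
             (step-off-root (adjacent (suc p) ssp<length) (inj₁ (rₛₚ , leaf (suc (suc p)) ssp<length (>⇒≢ ≤-refl)))))
      where
      p<length : p < length
      p<length = <-trans (n<1+n p) sp<length
      ssp<length : suc (suc p) < length
      ssp<length = <length sp<last
      ¬r₀ : ¬ InRootLayer (vertex 0)
      ¬r₀ = leaf 0 (≤-<-trans z≤n sp<length) λ ()

    two-root-vertices : ∃₂ λ i j → i < length × j < length × vertex i ≢ vertex j ×
      InRootLayer (vertex i) × InRootLayer (vertex j)
    two-root-vertices with meets-root
    ... | i , i<length , rᵢ with anyUpTo? (λ j → ¬? (j ≟ i) ×-dec root? j) length
    ...   | no none = ⊥-elim (lone-root i i<length rᵢ λ t t<length t≢i rₜ → none (t , t<length , t≢i , rₜ))
    ...   | yes (j , j<length , j≢i , rⱼ) with <-cmp i j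
    ...     | tri< i<j _ _ = i , j , i<length , j<length , distinct i j i<j j<length , rᵢ , rⱼ
    ...     | tri≈ _ i≡j _ = ⊥-elim (j≢i (sym i≡j))
    ...     | tri> _ _ j<i = j , i , j<length , i<length , distinct j i j<i i<length , rⱼ , rᵢ

record Square (H : Graph) : Set where
  field
    corner           : Fin 2 × Fin 2 → V H
    corner-injective : Injective _≡_ _≡_ corner
    bottom           : Adj H (corner (0F , 0F)) (corner (1F , 0F))
    right            : Adj H (corner (1F , 0F)) (corner (1F , 1F))
    top              : Adj H (corner (1F , 1F)) (corner (0F , 1F))
    left             : Adj H (corner (0F , 1F)) (corner (0F , 0F))

module MinorSquare {G H : Graph} (_≟_ : DecidableEquality (V G)) (minor : IsMinor H G) (Q : Square H) where
  open Square Q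

  private
    β : V G → Maybe (V H)
    β = proj₁ minor

  InSquare : V G → Set
  InSquare g = ∃ λ c → β g ≡ just (corner c)

  -- Forbidding the steps from the branch set of corner 00 to that of corner 01 makes the edge of G
  -- realising the side 01–00 available to close a walk around the square into a cycle.
  Step : V G → V G → Set
  Step a b = Adj G a b × InSquare b × ¬ (β a ≡ just (corner (0F , 0F)) × β b ≡ just (corner (0F , 1F)))

  private
    branch-unique : ∀ {g c c'} → β g ≡ just (corner c) → β g ≡ just (corner c') → c ≡ c'
    branch-unique βg≡c βg≡c' = corner-injective (just-injective (trans (sym βg≡c) βg≡c'))

    allowed : ∀ {x y c c'} → β x ≡ just (corner c) → β y ≡ just (corner c') → Adj G x y →
      (c , c') ≢ ((0F , 0F) , (0F , 1F)) → Step x y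
    allowed βx βy x~y ok = x~y , (_ , βy) , λ (βx' , βy') → ok (cong₂ _,_ (branch-unique βx βx') (branch-unique βy βy'))

    connected : ∀ h x y → β x ≡ just h → β y ≡ just h → WalkIn G (λ g → β g ≡ just h) x y
    connected = proj₁ (proj₂ (proj₂ minor))

    edge : ∀ {h h'} → Adj H h h' → Σ (V G) λ x → Σ (V G) λ y → β x ≡ just h × β y ≡ just h' × Adj G x y
    edge = proj₂ (proj₂ (proj₂ minor)) _ _

    first : ∀ {P : V G → Set} {x y} → WalkIn G P x y → P x
    first (here px) = px
    first (step px _ _) = px

    within-branch : ∀ c {x y} → WalkIn G (λ g → β g ≡ just (corner c)) x y → Star Step x y
    within-branch c (here _) = ε
    within-branch c (step βx x~z w) = allowed βx (first w) x~z (λ ()) ◅ within-branch c w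

  square-cycle : Σ (Cycle G) λ C → ∀ i → i < Cycle.length C → InSquare (Cycle.vertex C i)
  square-cycle with edge bottom | edge right | edge top | edge left
  ... | x₀₀ , y₁₀ , βx₀₀ , βy₁₀ , e₁ | x₁₀ , y₁₁ , βx₁₀ , βy₁₁ , e₂
      | x₁₁ , y₀₁ , βx₁₁ , βy₀₁ , e₃ | x₀₁ , y₀₀ , βx₀₁ , βy₀₀ , e₄ =
    closePath proj₁ path is-path e₄ (λ s → proj₂ (proj₂ s) (βy₀₀ , βx₀₁)) x₀₁≢y₀₀ ,
    λ i _ → vertexAt-all InSquare (proj₁ ∘ proj₂) ((0F , 0F) , βy₀₀) path i
    where
    inside : ∀ c {x y} → β x ≡ just (corner c) → β y ≡ just (corner c) → Star Step x y
    inside c βx βy = within-branch c (connected _ _ _ βx βy)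
    around : Star Step y₀₀ x₀₁
    around = inside (0F , 0F) βy₀₀ βx₀₀ ◅◅ allowed βx₀₀ βy₁₀ e₁ (λ ()) ◅
             inside (1F , 0F) βy₁₀ βx₁₀ ◅◅ allowed βx₁₀ βy₁₁ e₂ (λ ()) ◅
             inside (1F , 1F) βy₁₁ βx₁₁ ◅◅ allowed βx₁₁ βy₀₁ e₃ (λ ()) ◅
             inside (0F , 1F) βy₀₁ βx₀₁
    path : Star Step y₀₀ x₀₁
    path = proj₁ (shortcut _≟_ around)
    is-path : IsPath path
    is-path = proj₂ (shortcut _≟_ around)
    x₀₁≢y₀₀ : x₀₁ ≢ y₀₀
    x₀₁≢y₀₀ refl with branch-unique βx₀₁ βy₀₀
    ... | ()

grid-horizontal : ∀ {k} (x x' y : Fin k) → ∣ toℕ x - toℕ x' ∣ ≡ 1 → Adj (Grid k) (x , y) (x' , y)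
grid-horizontal _ _ y d = cong₂ _+_ d (∣n-n∣≡0 (toℕ y))

grid-vertical : ∀ {k} (x y y' : Fin k) → ∣ toℕ y - toℕ y' ∣ ≡ 1 → Adj (Grid k) (x , y) (x , y')
grid-vertical x _ _ d = cong₂ _+_ (∣n-n∣≡0 (toℕ x)) d

-- Square (a , b) has the corners (2a + e , 2b + d) for e, d ∈ {0, 1}.
module GridSquares {j k : ℕ} (j*2≤k : j * 2 ≤ k) where

  block : Fin j → Fin 2 → Fin k
  block a e = inject≤ (combine a e) j*2≤k

  block-injective : ∀ {a a' e e'} → block a e ≡ block a' e' → a ≡ a' × e ≡ e'
  block-injective {a} {a'} {e} {e'} eq = combine-injectiveˡ a e a' e' combine≡ , combine-injectiveʳ a e a' e' combine≡
    where
    combine≡ : combine a e ≡ combine a' e'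
    combine≡ = inject≤-injective j*2≤k j*2≤k _ _ eq

  block-gap : ∀ a → ∣ toℕ (block a 0F) - toℕ (block a 1F) ∣ ≡ 1
  block-gap a = begin
    ∣ toℕ (block a 0F) - toℕ (block a 1F) ∣ ≡⟨ cong₂ ∣_-_∣ (toℕ-block 0F) (toℕ-block 1F) ⟩
    ∣ 2 * toℕ a + 0 - 2 * toℕ a + 1 ∣       ≡⟨ ∣m+n-m+o∣≡∣n-o∣ (2 * toℕ a) 0 1 ⟩
    1                                       ∎
    where
    open ≡-Reasoning
    toℕ-block : ∀ e → toℕ (block a e) ≡ 2 * toℕ a + toℕ e
    toℕ-block e = trans (toℕ-inject≤ (combine a e) j*2≤k) (toℕ-combine a e)

  block-gap′ : ∀ a → ∣ toℕ (block a 1F) - toℕ (block a 0F) ∣ ≡ 1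
  block-gap′ a = trans (∣-∣-comm (toℕ (block a 1F)) _) (block-gap a)

  gridCorner : Fin j × Fin j → Fin 2 × Fin 2 → Fin k × Fin k
  gridCorner (a , b) (e , d) = block a e , block b d

  gridCorner-injective : ∀ {q q' c c'} → gridCorner q c ≡ gridCorner q' c' → q ≡ q' × c ≡ c'
  gridCorner-injective eq with block-injective (cong proj₁ eq) | block-injective (cong proj₂ eq)
  ... | refl , refl | refl , refl = refl , refl

  gridSquare : Fin j × Fin j → Square (Grid k)
  gridSquare q@(a , b) = record
    { corner           = gridCorner q
    ; corner-injective = proj₂ ∘ gridCorner-injective
    ; bottom           = grid-horizontal (block a 0F) (block a 1F) (block b 0F) (block-gap a)
    ; right            = grid-vertical (block a 1F) (block b 0F) (block b 1F) (block-gap b)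
    ; top              = grid-horizontal (block a 1F) (block a 0F) (block b 1F) (block-gap′ a)
    ; left             = grid-vertical (block a 0F) (block b 1F) (block b 0F) (block-gap′ b)
    }

↔⇒injective⇒≤ : ∀ {A : Set} {a n} → Fin a ↔ A → (f : A → Fin n) → Injective _≡_ _≡_ f → a ≤ n
↔⇒injective⇒≤ a↔A f f-injective = injective⇒≤ (Injection.injective (↔⇒↣ a↔A) ∘ f-injective)

⌊n/2⌋*2≤n : ∀ n → ⌊ n /2⌋ * 2 ≤ n
⌊n/2⌋*2≤n 0 = z≤n
⌊n/2⌋*2≤n 1 = z≤n
⌊n/2⌋*2≤n (suc (suc n)) = s≤s (s≤s (⌊n/2⌋*2≤n n))

n≤1+⌊n/2⌋*2 : ∀ n → n ≤ suc (⌊ n /2⌋ * 2)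
n≤1+⌊n/2⌋*2 0 = z≤n
n≤1+⌊n/2⌋*2 1 = ≤-refl
n≤1+⌊n/2⌋*2 (suc (suc n)) = s≤s (s≤s (n≤1+⌊n/2⌋*2 n))

module StarProductGridMinor {S : Graph} {n : ℕ} {AT : Fin n → Fin n → Set} (_≟S_ : DecidableEquality (V S))
  (star : IsStar S) (T-acyclic : ¬ HasCycle (mkFin n AT)) {k : ℕ} (minor : IsMinor (Grid k) (S □ mkFin n AT)) where

  open StarProduct {T = mkFin n AT} _≟S_ star T-acyclic
  open GridSquares {⌊ k /2⌋} (⌊n/2⌋*2≤n k)

  private
    j : ℕ
    j = ⌊ k /2⌋

    G : Graph
    G = S □ mkFin n AT

    module Lift (q : Fin j × Fin j) = MinorSquare (≡-dec _≟S_ _≟F_) minor (gridSquare q)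

  record RootPair (q : Fin j × Fin j) : Set where
    field
      vertex        : Fin 2 → V G
      distinct      : vertex 0F ≢ vertex 1F
      in-root-layer : ∀ e → InRootLayer (vertex e)
      in-square     : ∀ e → Lift.InSquare q (vertex e)

  -- Kept opaque: unfolding the construction makes comparing root vertices intractable.
  opaque
    root-pair : ∀ q → RootPair q
    root-pair q with Lift.square-cycle q
    ... | C , in-square with two-root-vertices C
    ...   | i , i' , i<length , i'<length , vᵢ≢vᵢ' , rᵢ , rᵢ' = record
      { vertex = λ { 0F → vertex i ; 1F → vertex i' }
      ; distinct = vᵢ≢vᵢ'
      ; in-root-layer = λ { 0F → rᵢ ; 1F → rᵢ' }
      ; in-square = λ { 0F → in-square i i<length ; 1F → in-square i' i'<length }
      }
      where open Cycle C using (vertex)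

  root-vertex : Fin j × Fin j → Fin 2 → V G
  root-vertex q = RootPair.vertex (root-pair q)

  square-determined : ∀ {q q' g} → Lift.InSquare q g → Lift.InSquare q' g → q ≡ q'
  square-determined (_ , βg≡c) (_ , βg≡c') = proj₁ (gridCorner-injective (just-injective (trans (sym βg≡c) βg≡c')))

  root-vertex-square : ∀ {q q' e e'} → root-vertex q e ≡ root-vertex q' e' → q ≡ q'
  root-vertex-square {q} {q'} {e} {e'} eq = square-determined (RootPair.in-square (root-pair q) e)
    (subst (Lift.InSquare q') (sym eq) (RootPair.in-square (root-pair q') e'))

  root-vertex-injective : ∀ {q q' e e'} → root-vertex q e ≡ root-vertex q' e' → (q , e) ≡ (q' , e')
  root-vertex-injective {q} {e = e} {e'} eq with root-vertex-square eq
  ... | refl = cong (q ,_) (same-index e e' eq)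
    where
    same-index : ∀ e e' → root-vertex q e ≡ root-vertex q e' → e ≡ e'
    same-index 0F 0F _ = refl
    same-index 1F 1F _ = refl
    same-index 0F 1F eq = ⊥-elim (RootPair.distinct (root-pair q) eq)
    same-index 1F 0F eq = ⊥-elim (RootPair.distinct (root-pair q) (sym eq))

  ⌊k/2⌋*⌊k/2⌋*2≤n : j * j * 2 ≤ n
  ⌊k/2⌋*⌊k/2⌋*2≤n = ↔⇒injective⇒≤ (↔-trans *↔× (*↔× ×-↔ ↔-refl)) tree-coordinate λ {(q , e)} {(q' , e')} eq →
    root-vertex-injective (×-≡,≡→≡ (trans (in-root q e) (sym (in-root q' e')) , eq))
    where
    tree-coordinate : (Fin j × Fin j) × Fin 2 → Fin n
    tree-coordinate (q , e) = proj₂ (root-vertex q e)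
    in-root : ∀ q e → InRootLayer (root-vertex q e)
    in-root q = RootPair.in-root-layer (root-pair q)

lemma16 : (m n : ℕ) (AS : Fin m → Fin m → Set) (AT : Fin n → Fin n → Set) →
    IsStar (mkFin m AS) → IsTree (mkFin n AT) →
    ∀ k → IsMinor (Grid k) (mkFin m AS □ mkFin n AT) → (k ∸ 1) ^ 2 ≤ 2 * n
lemma16 m n AS AT star (_ , _ , T-acyclic) k minor = begin
  (k ∸ 1) ^ 2         ≤⟨ ^-monoˡ-≤ 2 (∸-monoˡ-≤ 1 (n≤1+⌊n/2⌋*2 k)) ⟩
  (j * 2) ^ 2         ≡⟨ solve 1 (λ j → (j :* con 2) :^ 2 := con 2 :* (j :* j :* con 2)) refl j ⟩
  2 * (j * j * 2)     ≤⟨ *-monoʳ-≤ 2 (StarProductGridMinor.⌊k/2⌋*⌊k/2⌋*2≤n _≟F_ star T-acyclic minor) ⟩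
  2 * n               ∎
  where
  open ≤-Reasoning
  open +-*-Solver
  j : ℕ
  j = ⌊ k /2⌋
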